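{- Let $t$ be an infinite frieze. For all $i,j,p,q\in\mathbb{Z}$, \[ t(i,p)\,t(j,q)=t(i,j)\,t(p,q)+t(i,q)\,t(j,p). \]
   Context: An infinite frieze is a map $t:\mathbb{Z}\times\mathbb{Z}\to\mathbb{Z}$ such that $t(i,i)=0$; $t(i,j)\ge 1$ if $i<j$ and $t(i,i+1)=1$; $t(i,j)=-t(j,i)$ for all $i,j$; and $t(i,j)t(i+1,j+1)-t(i,j+1)t(i+1,j)=1$ for all $i,j\in\mathbb{Z}$. -}

module Defs where

open import Data.Integer using (ℤ; _+_; _-_; _*_; -_; _<_; _≤_; 0ℤ; 1ℤ)
open import Relation.Binary.PropositionalEquality using (_≡_)

record IsInfiniteFrieze (t : ℤ → ℤ → ℤ) : Set where
  field
    diag     : ∀ i → t i i ≡ 0ℤ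
    pos      : ∀ i j → i < j → 1ℤ ≤ t i j
    adjacent : ∀ i → t i (i + 1ℤ) ≡ 1ℤ
    antisym  : ∀ i j → t i j ≡ - t j i
    unimod   : ∀ i j →
      t i j * t (i + 1ℤ) (j + 1ℤ) - t i (j + 1ℤ) * t (i + 1ℤ) j ≡ 1ℤ

-- Write row h of the frieze as the sequence n ↦ t(h,n).
--  1. Any three consecutive rows satisfy a linear recurrence
--       t(h,n) + t(h+2,n) = t(h,h+2) · t(h+1,n).
--     Unimodularity says that the discrete Wronskian of row h+1 against
--     row h + row h+2 vanishes; the recurrence holds at n = h, h+1, h+2 by
--     the boundary values of the frieze, and the vanishing Wronskian carries
--     proportionality across every step n ↔ n+1 at which row h+1 is nonzero,
--     i.e. everywhere except at its diagonal zero n = h+1.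
--  2. Hence the 2×2 minor of rows h, h+1 at columns i, j does not depend on
--     h; evaluated at h = i it equals t(i,j). So t(i,j) is the minor of the
--     2×∞ matrix formed by rows 0 and 1 at columns i, j.
--  3. The theorem is then the three-term Plücker relation between the 2×2
--     minors of a 2×4 matrix, a polynomial identity.

module Submission where

open import Defs
open import Data.Integer using (ℤ; _+_; _*_)
open import Relation.Binary.PropositionalEquality using (_≡_)

open import Data.Nat using (zero; suc)
open import Data.Integer using (+_; -[1+_]; -_; _-_; 0ℤ; 1ℤ; -1ℤ; _<_; _≤_; _≟_; -<+)
open import Data.Integer.Properties
  using ( +-identityʳ; +-monoʳ-<; i≤i+j; <-cmp; <⇒≢; suc[i]≤j⇒i<j; neg-injective
        ; *-cancelˡ-≡; i-j≡0⇒i≡j)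
open import Data.Integer.Base using (≢-nonZero)
open import Data.Integer.Tactic.RingSolver using (solve-∀)
open import Relation.Binary.Definitions using (tri<; tri≈; tri>)
open import Relation.Nullary using (yes; no)
open import Relation.Binary.PropositionalEquality
  using (_≢_; refl; sym; trans; cong; cong₂; subst; ≢-sym; module ≡-Reasoning)

ℤ-induction-from : (P : ℤ → Set) (a : ℤ) → P a →
  (∀ n → a ≤ n → P n → P (n + 1ℤ)) →
  (∀ n → n < a → P (n + 1ℤ) → P n) →
  ∀ n → P n
ℤ-induction-from P a base up down n = subst P (a+[n-a]≡n a n) (from (n - a))
  where
  a+[n-a]≡n : ∀ a n → a + (n - a) ≡ n
  a+[n-a]≡n = solve-∀

  shift : ∀ a x → (a + x) + 1ℤ ≡ a + (1ℤ + x)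
  shift = solve-∀

  above : ∀ d → P (a + + d)
  above zero    = subst P (sym (+-identityʳ a)) base
  above (suc d) = subst P (shift a (+ d)) (up _ (i≤i+j a (+ d)) (above d))

  below-a : ∀ d → a + -[1+ d ] < a
  below-a d = subst (a + -[1+ d ] <_) (+-identityʳ a) (+-monoʳ-< a -<+)

  below : ∀ d → P (a + -[1+ d ])
  below zero    = down _ (below-a 0) (subst P (sym (trans (shift a -1ℤ) (+-identityʳ a))) base)
  below (suc d) = down _ (below-a (suc d)) (subst P (sym (shift a -[1+ suc d ])) (below d))

  from : ∀ δ → P (a + δ)
  from (+ d)    = above d
  from -[1+ d ] = below d

step-invariant⇒constant : (f : ℤ → ℤ) → (∀ h → f h ≡ f (h + 1ℤ)) → ∀ a n → f n ≡ f a
step-invariant⇒constant f step a =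
  ℤ-induction-from (λ n → f n ≡ f a) a refl
    (λ n _ fn≡fa → trans (sym (step n)) fn≡fa)
    (λ n _ fn+1≡fa → trans (step n) fn+1≡fa)

positive⇒nonzero : ∀ {x} → 1ℤ ≤ x → x ≢ 0ℤ
positive⇒nonzero 1≤x = ≢-sym (<⇒≢ (suc[i]≤j⇒i<j 1≤x))

proportionality-transfer : ∀ {a a' b b'} c → a ≢ 0ℤ →
  a * b' ≡ a' * b → b ≡ c * a → b' ≡ c * a'
proportionality-transfer {a} {a'} {b} {b'} c a≢0 det≡0 b≡ca =
  *-cancelˡ-≡ a b' (c * a') {{≢-nonZero a≢0}} (begin
    a * b'        ≡⟨ det≡0 ⟩
    a' * b        ≡⟨ cong (a' *_) b≡ca ⟩
    a' * (c * a)  ≡⟨ rearrange a' c a ⟩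
    a * (c * a')  ∎)
  where
  open ≡-Reasoning
  rearrange : ∀ x y z → x * (y * z) ≡ z * (y * x)
  rearrange = solve-∀

proportional-everywhere : (A B : ℤ → ℤ) (c h : ℤ) →
  (∀ n → A n * B (n + 1ℤ) ≡ A (n + 1ℤ) * B n) →
  (∀ n → n ≢ h + 1ℤ → A n ≢ 0ℤ) →
  B h ≡ c * A h → B (h + 1ℤ) ≡ c * A (h + 1ℤ) →
  B (h + 1ℤ + 1ℤ) ≡ c * A (h + 1ℤ + 1ℤ) →
  ∀ n → B n ≡ c * A n
proportional-everywhere A B c h wronskian nonzero at-h at-h+1 at-h+2 =
  ℤ-induction-from (λ n → B n ≡ c * A n) (h + 1ℤ) at-h+1 up down
  where
  +1-injective : ∀ {m n} → m + 1ℤ ≡ n + 1ℤ → m ≡ n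
  +1-injective {m} {n} eq = trans (sym (undo m)) (trans (cong (_- 1ℤ) eq) (undo n))
    where
    undo : ∀ x → (x + 1ℤ) - 1ℤ ≡ x
    undo = solve-∀

  up : ∀ n → h + 1ℤ ≤ n → B n ≡ c * A n → B (n + 1ℤ) ≡ c * A (n + 1ℤ)
  up n _ prop with n ≟ h + 1ℤ
  ... | yes refl = at-h+2
  ... | no n≢h+1 = proportionality-transfer c (nonzero n n≢h+1) (wronskian n) prop

  down : ∀ n → n < h + 1ℤ → B (n + 1ℤ) ≡ c * A (n + 1ℤ) → B n ≡ c * A n
  down n _ prop with n ≟ h
  ... | yes refl = at-h
  ... | no n≢h   = proportionality-transfer c
    (nonzero (n + 1ℤ) (λ eq → n≢h (+1-injective eq))) (sym (wronskian n)) prop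

recurrence-preserves-minor : ∀ x₀ x₁ x₂ y₀ y₁ y₂ c →
  x₀ + x₂ ≡ c * x₁ → y₀ + y₂ ≡ c * y₁ →
  x₀ * y₁ - x₁ * y₀ ≡ x₁ * y₂ - x₂ * y₁
recurrence-preserves-minor x₀ x₁ x₂ y₀ y₁ y₂ c rec-x rec-y = begin
  x₀ * y₁ - x₁ * y₀                               ≡⟨ cong₂ (λ x y → x * y₁ - x₁ * y)
                                                       (isolate x₀ x₂ c x₁ rec-x)
                                                       (isolate y₀ y₂ c y₁ rec-y) ⟩
  (c * x₁ - x₂) * y₁ - x₁ * (c * y₁ - y₂)         ≡⟨ expand x₁ x₂ y₁ y₂ c ⟩
  x₁ * y₂ - x₂ * y₁                               ∎
  where
  open ≡-Reasoning
  isolate : ∀ u v c w → u + v ≡ c * w → u ≡ c * w - v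
  isolate u v c w eq = trans (sym (cancel u v)) (cong (_- v) eq)
    where
    cancel : ∀ u v → (u + v) - v ≡ u
    cancel = solve-∀
  expand : ∀ x₁ x₂ y₁ y₂ c →
    (c * x₁ - x₂) * y₁ - x₁ * (c * y₁ - y₂) ≡ x₁ * y₂ - x₂ * y₁
  expand = solve-∀

plücker : ∀ aᵢ bᵢ aⱼ bⱼ aₚ bₚ a_q b_q →
  (aᵢ * bₚ - bᵢ * aₚ) * (aⱼ * b_q - bⱼ * a_q) ≡
  (aᵢ * bⱼ - bᵢ * aⱼ) * (aₚ * b_q - bₚ * a_q) + (aᵢ * b_q - bᵢ * a_q) * (aⱼ * bₚ - bⱼ * aₚ)
plücker = solve-∀

module Frieze (t : ℤ → ℤ → ℤ) (fr : IsInfiniteFrieze t) where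
  open IsInfiniteFrieze fr

  subdiagonal : ∀ i → t (i + 1ℤ) i ≡ -1ℤ
  subdiagonal i = trans (antisym (i + 1ℤ) i) (cong -_ (adjacent i))

  off-diagonal-nonzero : ∀ i j → i ≢ j → t i j ≢ 0ℤ
  off-diagonal-nonzero i j i≢j with <-cmp i j
  ... | tri< i<j _ _ = positive⇒nonzero (pos i j i<j)
  ... | tri≈ _ i≡j _ = λ _ → i≢j i≡j
  ... | tri> _ _ j<i = λ tij≡0 →
    positive⇒nonzero (pos j i j<i) (neg-injective (trans (sym (antisym i j)) tij≡0))

  row-recurrence : ∀ h n → t h n + t (h + 1ℤ + 1ℤ) n ≡ t h (h + 1ℤ + 1ℤ) * t (h + 1ℤ) n
  row-recurrence h = proportional-everywhere middle outer c h
    wronskian nonzero at-h at-h+1 at-h+2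
    where
    h₁ = h + 1ℤ
    h₂ = h₁ + 1ℤ
    c = t h h₂

    middle outer : ℤ → ℤ
    middle n = t h₁ n
    outer n = t h n + t h₂ n

    -- The Wronskian is the difference of the unimodular rule at rows h+1 and h.
    wronskian : ∀ n → middle n * outer (n + 1ℤ) ≡ middle (n + 1ℤ) * outer n
    wronskian n = i-j≡0⇒i≡j _ _ (begin
        middle n * outer (n + 1ℤ) - middle (n + 1ℤ) * outer n
      ≡⟨ regroup (t h n) (t h (n + 1ℤ)) (t h₁ n) (t h₁ (n + 1ℤ)) (t h₂ n) (t h₂ (n + 1ℤ)) ⟩
        (t h₁ n * t h₂ (n + 1ℤ) - t h₁ (n + 1ℤ) * t h₂ n)
          - (t h n * t h₁ (n + 1ℤ) - t h (n + 1ℤ) * t h₁ n)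
      ≡⟨ cong₂ _-_ (unimod h₁ n) (unimod h n) ⟩
        1ℤ - 1ℤ
      ∎)
      where
      open ≡-Reasoning
      regroup : ∀ a₀ a₁ b₀ b₁ c₀ c₁ →
        b₀ * (a₁ + c₁) - b₁ * (a₀ + c₀) ≡ (b₀ * c₁ - b₁ * c₀) - (a₀ * b₁ - a₁ * b₀)
      regroup = solve-∀

    nonzero : ∀ n → n ≢ h₁ → middle n ≢ 0ℤ
    nonzero n n≢h₁ = off-diagonal-nonzero h₁ n (≢-sym n≢h₁)

    at-h : outer h ≡ c * middle h
    at-h = begin
      t h h + t h₂ h   ≡⟨ cong₂ _+_ (diag h) (antisym h₂ h) ⟩
      0ℤ + - c         ≡⟨ negate c ⟩
      c * -1ℤ          ≡⟨ cong (c *_) (sym (subdiagonal h)) ⟩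
      c * t h₁ h       ∎
      where
      open ≡-Reasoning
      negate : ∀ x → 0ℤ + - x ≡ x * -1ℤ
      negate = solve-∀

    at-h+1 : outer h₁ ≡ c * middle h₁
    at-h+1 = begin
      t h h₁ + t h₂ h₁  ≡⟨ cong₂ _+_ (adjacent h) (subdiagonal h₁) ⟩
      1ℤ + -1ℤ          ≡⟨ annihilate c ⟩
      c * 0ℤ            ≡⟨ cong (c *_) (sym (diag h₁)) ⟩
      c * t h₁ h₁       ∎
      where
      open ≡-Reasoning
      annihilate : ∀ x → 1ℤ + -1ℤ ≡ x * 0ℤ
      annihilate = solve-∀

    at-h+2 : outer h₂ ≡ c * middle h₂
    at-h+2 = begin
      c + t h₂ h₂   ≡⟨ cong (λ x → c + x) (diag h₂) ⟩
      c + 0ℤ        ≡⟨ unit c ⟩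
      c * 1ℤ        ≡⟨ cong (c *_) (sym (adjacent h₁)) ⟩
      c * t h₁ h₂   ∎
      where
      open ≡-Reasoning
      unit : ∀ x → x + 0ℤ ≡ x * 1ℤ
      unit = solve-∀

  row-minor : ℤ → ℤ → ℤ → ℤ
  row-minor i j h = t h i * t (h + 1ℤ) j - t (h + 1ℤ) i * t h j

  row-minor-step : ∀ i j h → row-minor i j h ≡ row-minor i j (h + 1ℤ)
  row-minor-step i j h = recurrence-preserves-minor
    (t h i) (t (h + 1ℤ) i) (t (h + 1ℤ + 1ℤ) i) (t h j) (t (h + 1ℤ) j) (t (h + 1ℤ + 1ℤ) j)
    (t h (h + 1ℤ + 1ℤ)) (row-recurrence h i) (row-recurrence h j)

  row-minor-at-diagonal : ∀ i j → row-minor i j i ≡ t i j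
  row-minor-at-diagonal i j = begin
    t i i * t (i + 1ℤ) j - t (i + 1ℤ) i * t i j  ≡⟨ cong₂ (λ x y → x * t (i + 1ℤ) j - y * t i j)
                                                      (diag i) (subdiagonal i) ⟩
    0ℤ * t (i + 1ℤ) j - -1ℤ * t i j              ≡⟨ simplify (t (i + 1ℤ) j) (t i j) ⟩
    t i j                                        ∎
    where
    open ≡-Reasoning
    simplify : ∀ x y → 0ℤ * x - -1ℤ * y ≡ y
    simplify = solve-∀

  entry-as-minor : ∀ i j → t i j ≡ t 0ℤ i * t 1ℤ j - t 1ℤ i * t 0ℤ j
  entry-as-minor i j = begin
    t i j               ≡⟨ sym (row-minor-at-diagonal i j) ⟩
    row-minor i j i     ≡⟨ step-invariant⇒constant (row-minor i j) (row-minor-step i j) 0ℤ i ⟩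
    row-minor i j 0ℤ    ∎
    where open ≡-Reasoning

proposition1p9 : (t : ℤ → ℤ → ℤ) → IsInfiniteFrieze t →
    ∀ i j p q → t i p * t j q ≡ t i j * t p q + t i q * t j p
proposition1p9 t fr i j p q = begin
    t i p * t j q
  ≡⟨ cong₂ _*_ (entry-as-minor i p) (entry-as-minor j q) ⟩
    minor i p * minor j q
  ≡⟨ plücker (t 0ℤ i) (t 1ℤ i) (t 0ℤ j) (t 1ℤ j) (t 0ℤ p) (t 1ℤ p) (t 0ℤ q) (t 1ℤ q) ⟩
    minor i j * minor p q + minor i q * minor j p
  ≡⟨ sym (cong₂ _+_ (cong₂ _*_ (entry-as-minor i j) (entry-as-minor p q))
                    (cong₂ _*_ (entry-as-minor i q) (entry-as-minor j p))) ⟩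
    t i j * t p q + t i q * t j p
  ∎
  where
  open ≡-Reasoning
  open Frieze t fr using (entry-as-minor)
  minor : ℤ → ℤ → ℤ
  minor k l = t 0ℤ k * t 1ℤ l - t 1ℤ k * t 0ℤ l
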